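{- Let $G=(V,E)$ be a finite simple graph with $V=\{1,\dots,N\}$, and let $\tilde o$ be a partition of $V$ into independent sets (blocks), with $s$ blocks. Let $P_{\tilde o}=[0,1]^N\cap\{x\in\mathbb R^N: x_i=x_j \text{ whenever } i,j \text{ lie in the same block of }\tilde o\}$ and let $\mathcal H(G,\tilde o)$ be the arrangement consisting of the hyperplanes $x_i=x_j$ for $\{i,j\}\in E$ together with the hyperplanes $x_i=x_j$ for all $i,j$ lying in different blocks of $\tilde o$. Then for every positive integer $t$, $$(-1)^s E_{P_{\tilde o},\mathcal H(G,\tilde o)}(-t)=E^{\circ}_{\operatorname{relint}(P_{\tilde o}),\mathcal H(G,\tilde o)}(t)=\chi_{G,\tilde o}(t-1).$$ Furthermore, $\chi_{G,\tilde o}$ is a polynomial of degree $s$ with leading coefficient $1$.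
   Context: A proper $t$-coloring of $G$ is a map $c\colon V\to\{1,\dots,t\}$ with $c(i)\ne c(j)$ for every edge $\{i,j\}$. A coloring lies in $\tilde o$ if two vertices receive the same color exactly when they lie in the same block of $\tilde o$ (these partitions are exactly the orbits of proper colorings under permutation of colors). $\chi_{G,\tilde o}(t)$ denotes the number of proper $t$-colorings of $G$ lying in $\tilde o$. For a polytope $P$ and a hyperplane arrangement $\mathcal H$ in its affine hull: $E^{\circ}_{\operatorname{relint}(P),\mathcal H}(t)=\#\big(\mathbb Z^N\cap t[\operatorname{relint}(P)\setminus\bigcup\mathcal H]\big)$; the closed regions of $(tP,\mathcal H)$ are the closures of the connected components of $tP\setminus\bigcup\mathcal H$; $m_{tP,\mathcal H}(x)$ is the number of closed regions containing $x$ (and $0$ if $x\notin tP$); and $E_{P,\mathcal H}(t)=\sum_{x\in\mathbb Z^N}m_{tP,\mathcal H}(x)$, which is a polynomial in $t$ and is evaluated at $-t$ as such. -}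

module Defs where

open import Data.Nat using (ℕ; zero; suc)
open import Data.Fin using (Fin; toℕ)
open import Data.Bool using (Bool; true; false)
open import Data.Integer using (+_)
open import Data.Rational using (ℚ; 0ℚ; 1ℚ; _+_; _*_; -_; _≤_; _<_; _/_)
open import Data.List using (List; []; _∷_; map; concatMap; allFin)
open import Data.Nat.ListAction using (sum)
open import Data.Vec using (Vec; []; _∷_; lookup)
open import Data.Product using (Σ; Σ-syntax; ∃; _×_; _,_)
open import Data.Sum using (_⊎_)
open import Function.Bundles using (_⇔_)
open import Function.Definitions using (Injective)
open import Relation.Binary.PropositionalEquality using (_≡_; _≢_)
open import Relation.Nullary using (¬_)

Card : {A : Set} → (A → Set) → ℕ → Set
Card {A} P k =
  Σ[ f ∈ (Fin k → A) ] (Injective _≡_ _≡_ f × (∀ a → (P a ⇔ (∃ λ i → f i ≡ a))))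

allVec : (n N : ℕ) → List (Vec (Fin n) N)
allVec n zero    = [] ∷ []
allVec n (suc N) = concatMap (λ v → map (λ a → a ∷ v) (allFin n)) (allVec n N)

ℕ→ℚ : ℕ → ℚ
ℕ→ℚ n = + n / 1

signPow : ℕ → ℚ
signPow zero    = 1ℚ
signPow (suc s) = - signPow s

evalPoly : List ℚ → ℚ → ℚ
evalPoly []       x = 0ℚ
evalPoly (c ∷ cs) x = c + x * evalPoly cs x

-- Setting: a graph on V = Fin N given by a Bool adjacency function, and
-- a partition õ of V into s blocks given by the block map b : Fin N → Fin s.

module _ {N s : ℕ} (adj : Fin N → Fin N → Bool) (b : Fin N → Fin s) where

  Hyp : Fin N → Fin N → Set
  Hyp i j = (adj i j ≡ true) ⊎ (b i ≢ b j)

  InTP : ℕ → (Fin N → ℚ) → Set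
  InTP t x = (∀ i → (0ℚ ≤ x i) × (x i ≤ ℕ→ℚ t))
           × (∀ i j → b i ≡ b j → x i ≡ x j)

  InRelint : ℕ → (Fin N → ℚ) → Set
  InRelint t x = (∀ i → (0ℚ < x i) × (x i < ℕ→ℚ t))
               × (∀ i j → b i ≡ b j → x i ≡ x j)

  OffH : (Fin N → ℚ) → Set
  OffH x = ∀ i j → Hyp i j → x i ≢ x j

  -- sign patterns: pat p i j = true records the side x_i < x_j of the
  -- hyperplane x_i = x_j; entries for non-hyperplane pairs are set to false
  Pattern : Set
  Pattern = Vec (Vec Bool N) N

  pat : Pattern → Fin N → Fin N → Bool
  pat p i j = lookup (lookup p i) j

  -- the pattern p is the pattern of a connected component (region) of
  -- tP \ ⋃H, i.e. that open cell of tP \ ⋃H is nonempty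
  Realizable : ℕ → Pattern → Set
  Realizable t p =
    Σ[ y ∈ (Fin N → ℚ) ] InTP t y
      × (∀ i j → Hyp i j → ((pat p i j ≡ true → y i < y j) × (pat p i j ≡ false → y j < y i)))
      × (∀ i j → ¬ Hyp i j → pat p i j ≡ false)

  InClosure : ℕ → Pattern → (Fin N → ℚ) → Set
  InClosure t p x = InTP t x × (∀ i j → Hyp i j → pat p i j ≡ true → x i ≤ x j)

  InClosedRegion : ℕ → (Fin N → ℚ) → Pattern → Set
  InClosedRegion t x p = Realizable t p × InClosure t p x

  -- integer points of [0,t]^N (all other lattice points lie outside tP)
  pt : {t : ℕ} → Vec (Fin (suc t)) N → Fin N → ℚ
  pt x i = ℕ→ℚ (toℕ (lookup x i))

  EVal : ℕ → ℕ → Set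
  EVal t e =
    Σ[ m ∈ (Vec (Fin (suc t)) N → ℕ) ]
      (∀ x → Card (InClosedRegion t (pt x)) (m x))
      × (sum (map m (allVec (suc t) N)) ≡ e)

  InteriorPt : (t : ℕ) → Vec (Fin (suc t)) N → Set
  InteriorPt t x = InRelint t (pt x) × OffH (pt x)

  -- proper t-colorings lying in õ (colors {1,…,t} represented by Fin t)
  ColoringIn : (t : ℕ) → Vec (Fin t) N → Set
  ColoringIn t c = (∀ i j → adj i j ≡ true → lookup c i ≢ lookup c j)
                 × (∀ i j → ((lookup c i ≡ lookup c j) ⇔ (b i ≡ b j)))

{-# OPTIONS --safe #-}
module Submission where

-- Since the blocks of õ are independent and H(G,õ) contains every hyperplane x_i = x_j between two
-- blocks, only the s block coordinates matter: P_õ is the cube [0,1]^s and H(G,õ) is the braid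
-- arrangement on it. A proper coloring in õ with t - 1 colors and a lattice point of t·relint(P_õ) off
-- H(G,õ) are then both injections of the blocks into a set of t - 1 values, so both are counted by the
-- falling factorial (t - 1)(t - 2)⋯(t - s). The closed regions of (tP_õ, H) are indexed by the s!
-- orderings of the blocks, and a lattice point of [0,t]^s lies in the region of an ordering iff its
-- coordinates weakly increase along it. Pairing each ordering with a weakly increasing sequence gives
-- E(t) = s! · multichoose(t + 1, s) = (t + 1)(t + 2)⋯(t + s), and substituting -t into this product
-- yields (-1)^s (t - 1)(t - 2)⋯(t - s).

open import Defs

open import Data.Bool using (Bool; true; false)
open import Data.Empty using (⊥-elim)
open import Data.Fin as Fin using (Fin; toℕ)
import Data.Fin.Properties as Fin
open import Data.Integer as ℤ using (+_)
import Data.Integer.Properties as ℤ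
open import Data.List as List using (List; []; _∷_; _++_; [_]; length)
open import Data.List.Membership.Propositional using (_∈_)
open import Data.List.Membership.Propositional.Properties
  using (∈-concatMap⁺; ∈-concatMap⁻; ∈-map⁺; ∈-map⁻; ∈-allFin)
import Data.List.Relation.Unary.All as All
open import Data.List.Relation.Unary.AllPairs using ([]; _∷_)
open import Data.List.Relation.Unary.Any as Any using (here; there)
open import Data.List.Relation.Unary.Unique.Propositional using (Unique)
import Data.List.Relation.Unary.Unique.Propositional.Properties as Unique
open import Data.Nat as ℕ using (ℕ; zero; suc; z≤n; s≤s)
open import Data.Nat.ListAction using (sum)
import Data.Nat.Properties as ℕ
open import Data.Product using (Σ-syntax; ∃; _×_; _,_; proj₁; proj₂; uncurry)
open import Data.Rational as ℚ using (ℚ; 0ℚ; 1ℚ; _+_; _*_; -_; _-_)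
open import Data.Rational.Solver using (module +-*-Solver)
import Data.Rational.Unnormalised as ℚᵘ
import Data.Rational.Unnormalised.Properties as ℚᵘ
import Data.Rational.Properties as ℚ
open import Data.Sum as Sum using (_⊎_; inj₁; inj₂)
open import Data.Unit using (⊤; tt)
open import Data.Vec as Vec using (Vec; []; _∷_; lookup; tabulate; toList)
open import Data.Vec.Membership.Propositional using () renaming (_∈_ to _∈ᵥ_)
open import Data.Vec.Membership.Propositional.Properties using (∈-allFin⁺)
open import Data.Vec.Relation.Unary.Any using (here; there)
import Data.Vec.Properties as Vec
open import Function.Base using (_∘_)
open import Function.Bundles using (_⇔_; mk⇔; Equivalence)
open import Function.Definitions using (Injective; Surjective)
open import Level using (0ℓ)
open import Relation.Binary.Bundles using (StrictTotalOrder)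
open import Relation.Binary.PropositionalEquality hiding ([_])
open import Relation.Nullary using (¬_; Dec; does; yes; no)
open import Relation.Nullary.Decidable using (decidable-stable; dec-true; dec-false; _→-dec_; _×-dec_)
open import Relation.Unary using (Decidable)

open import Algebra.Properties.CommutativeSemigroup ℕ.*-commutativeSemigroup using (x∙yz≈y∙xz)
open +-*-Solver using (solve; _:+_; _:*_; :-_; _:=_; con)
open Equivalence using (to; from)

-- The embedding ℕ → ℚ

toℚᵘ-ℕ→ℚ : ∀ n → ℚ.toℚᵘ (ℕ→ℚ n) ℚᵘ.≃ ℚᵘ.mkℚᵘ (+ n) 0
toℚᵘ-ℕ→ℚ n = ℚ.toℚᵘ-fromℚᵘ (ℚᵘ.mkℚᵘ (+ n) 0)

ℕ→ℚ-homo-+ : ∀ m n → ℕ→ℚ (m ℕ.+ n) ≡ ℕ→ℚ m + ℕ→ℚ n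
ℕ→ℚ-homo-+ m n = ℚ.toℚᵘ-injective (begin
  ℚ.toℚᵘ (ℕ→ℚ (m ℕ.+ n))
    ≈⟨ toℚᵘ-ℕ→ℚ (m ℕ.+ n) ⟩
  ℚᵘ.mkℚᵘ (+ (m ℕ.+ n)) 0
    ≈⟨ ℚᵘ.*≡* (cong (ℤ._* + 1) (sym (cong₂ ℤ._+_ (ℤ.*-identityʳ (+ m)) (ℤ.*-identityʳ (+ n))))) ⟩
  ℚᵘ.mkℚᵘ (+ m) 0 ℚᵘ.+ ℚᵘ.mkℚᵘ (+ n) 0
    ≈⟨ ℚᵘ.+-cong (ℚᵘ.≃-sym (toℚᵘ-ℕ→ℚ m)) (ℚᵘ.≃-sym (toℚᵘ-ℕ→ℚ n)) ⟩
  ℚ.toℚᵘ (ℕ→ℚ m) ℚᵘ.+ ℚ.toℚᵘ (ℕ→ℚ n)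
    ≈⟨ ℚᵘ.≃-sym (ℚ.toℚᵘ-homo-+ (ℕ→ℚ m) (ℕ→ℚ n)) ⟩
  ℚ.toℚᵘ (ℕ→ℚ m + ℕ→ℚ n)
    ∎)
  where open ℚᵘ.≃-Reasoning

ℕ→ℚ-homo-* : ∀ m n → ℕ→ℚ (m ℕ.* n) ≡ ℕ→ℚ m * ℕ→ℚ n
ℕ→ℚ-homo-* m n = ℚ.toℚᵘ-injective (begin
  ℚ.toℚᵘ (ℕ→ℚ (m ℕ.* n))
    ≈⟨ toℚᵘ-ℕ→ℚ (m ℕ.* n) ⟩
  ℚᵘ.mkℚᵘ (+ (m ℕ.* n)) 0
    ≈⟨ ℚᵘ.*≡* (cong (ℤ._* + 1) (ℤ.pos-* m n)) ⟩
  ℚᵘ.mkℚᵘ (+ m) 0 ℚᵘ.* ℚᵘ.mkℚᵘ (+ n) 0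
    ≈⟨ ℚᵘ.*-cong (ℚᵘ.≃-sym (toℚᵘ-ℕ→ℚ m)) (ℚᵘ.≃-sym (toℚᵘ-ℕ→ℚ n)) ⟩
  ℚ.toℚᵘ (ℕ→ℚ m) ℚᵘ.* ℚ.toℚᵘ (ℕ→ℚ n)
    ≈⟨ ℚᵘ.≃-sym (ℚ.toℚᵘ-homo-* (ℕ→ℚ m) (ℕ→ℚ n)) ⟩
  ℚ.toℚᵘ (ℕ→ℚ m * ℕ→ℚ n)
    ∎)
  where open ℚᵘ.≃-Reasoning

ℕ→ℚ-suc : ∀ n → ℕ→ℚ (suc n) ≡ 1ℚ + ℕ→ℚ n
ℕ→ℚ-suc = ℕ→ℚ-homo-+ 1

ℕ→ℚ-mono-≤ : ∀ {m n} → m ℕ.≤ n → ℕ→ℚ m ℚ.≤ ℕ→ℚ n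
ℕ→ℚ-mono-≤ {m} m≤n with d , refl ← ℕ.m≤n⇒∃[o]m+o≡n m≤n = begin
  ℕ→ℚ m          ≡⟨ ℚ.+-identityʳ (ℕ→ℚ m) ⟨
  ℕ→ℚ m + 0ℚ     ≤⟨ ℚ.+-monoʳ-≤ (ℕ→ℚ m) (ℚ.nonNegative⁻¹ _ {{ℚ.normalize-nonNeg d 1}}) ⟩
  ℕ→ℚ m + ℕ→ℚ d  ≡⟨ ℕ→ℚ-homo-+ m d ⟨
  ℕ→ℚ (m ℕ.+ d)  ∎
  where open ℚ.≤-Reasoning

ℕ→ℚ-mono-< : ∀ {m n} → m ℕ.< n → ℕ→ℚ m ℚ.< ℕ→ℚ n
ℕ→ℚ-mono-< {m} m<n with d , refl ← ℕ.m≤n⇒∃[o]m+o≡n m<n = begin-strict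
  ℕ→ℚ m                ≡⟨ ℚ.+-identityʳ (ℕ→ℚ m) ⟨
  ℕ→ℚ m + 0ℚ           <⟨ ℚ.+-monoʳ-< (ℕ→ℚ m) (ℚ.positive⁻¹ _ {{ℚ.normalize-pos (suc d) 1}}) ⟩
  ℕ→ℚ m + ℕ→ℚ (suc d)  ≡⟨ ℕ→ℚ-homo-+ m (suc d) ⟨
  ℕ→ℚ (m ℕ.+ suc d)    ≡⟨ cong ℕ→ℚ (ℕ.+-suc m d) ⟩
  ℕ→ℚ (suc m ℕ.+ d)    ∎
  where open ℚ.≤-Reasoning

ℕ→ℚ-cancel-≤ : ∀ {m n} → ℕ→ℚ m ℚ.≤ ℕ→ℚ n → m ℕ.≤ n
ℕ→ℚ-cancel-≤ m≤n = ℕ.≮⇒≥ (λ n<m → ℚ.<-irrefl refl (ℚ.<-≤-trans (ℕ→ℚ-mono-< n<m) m≤n))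

ℕ→ℚ-cancel-< : ∀ {m n} → ℕ→ℚ m ℚ.< ℕ→ℚ n → m ℕ.< n
ℕ→ℚ-cancel-< m<n = ℕ.≰⇒> (λ n≤m → ℚ.<-irrefl refl (ℚ.<-≤-trans m<n (ℕ→ℚ-mono-≤ n≤m)))

ℕ→ℚ-injective : ∀ {m n} → ℕ→ℚ m ≡ ℕ→ℚ n → m ≡ n
ℕ→ℚ-injective eq =
  ℕ.≤-antisym (ℕ→ℚ-cancel-≤ (ℚ.≤-reflexive eq)) (ℕ→ℚ-cancel-≤ (ℚ.≤-reflexive (sym eq)))

-- Monic polynomials and products of linear factors

evalMonic : ∀ {n} → Vec ℚ n → ℚ → ℚ
evalMonic q = evalPoly (toList q ++ [ 1ℚ ])

addHead : ∀ {n} → ℚ → Vec ℚ (suc n) → Vec ℚ (suc n)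
addHead c (d ∷ ds) = c + d ∷ ds

mulXPlus : ∀ {n} → ℚ → Vec ℚ n → Vec ℚ (suc n)
mulXPlus a []      = a ∷ []
mulXPlus a (c ∷ q) = a * c ∷ addHead c (mulXPlus a q)

evalMonic-addHead : ∀ {n} c (q : Vec ℚ (suc n)) x → evalMonic (addHead c q) x ≡ c + evalMonic q x
evalMonic-addHead c (d ∷ ds) x = ℚ.+-assoc c d (x * evalMonic ds x)

evalMonic-mulXPlus : ∀ {n} a (q : Vec ℚ n) x → evalMonic (mulXPlus a q) x ≡ (x + a) * evalMonic q x
evalMonic-mulXPlus a [] x =
  solve 2 (λ a x → a :+ x :* (con 1ℚ :+ x :* con 0ℚ) := (x :+ a) :* (con 1ℚ :+ x :* con 0ℚ)) refl a x
evalMonic-mulXPlus a (c ∷ q) x = begin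
  a * c + x * evalMonic (addHead c (mulXPlus a q)) x
    ≡⟨ cong (λ e → a * c + x * e) (evalMonic-addHead c (mulXPlus a q) x) ⟩
  a * c + x * (c + evalMonic (mulXPlus a q) x)
    ≡⟨ cong (λ e → a * c + x * (c + e)) (evalMonic-mulXPlus a q x) ⟩
  a * c + x * (c + (x + a) * Q)
    ≡⟨ solve 4 (λ a c x Q → a :* c :+ x :* (c :+ (x :+ a) :* Q) := (x :+ a) :* (c :+ x :* Q)) refl a c x Q ⟩
  (x + a) * (c + x * Q)
    ∎
  where
  open ≡-Reasoning
  Q = evalMonic q x

∏linear : (ℕ → ℚ) → ℕ → ℚ → ℚ
∏linear a zero    x = 1ℚ
∏linear a (suc s) x = (x + a s) * ∏linear a s x

monicProduct : (ℕ → ℚ) → (s : ℕ) → Vec ℚ s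
monicProduct a zero    = []
monicProduct a (suc s) = mulXPlus (a s) (monicProduct a s)

evalMonic-monicProduct : ∀ a s x → evalMonic (monicProduct a s) x ≡ ∏linear a s x
evalMonic-monicProduct a zero    x = trans (cong (λ e → 1ℚ + e) (ℚ.*-zeroʳ x)) (ℚ.+-identityʳ 1ℚ)
evalMonic-monicProduct a (suc s) x = trans (evalMonic-mulXPlus (a s) (monicProduct a s) x)
                                           (cong ((x + a s) *_) (evalMonic-monicProduct a s x))

∏linear-shift : ∀ a b s {x y} → (∀ i → x + a i ≡ y + b i) → ∏linear a s x ≡ ∏linear b s y
∏linear-shift a b zero    eq = refl
∏linear-shift a b (suc s) eq = cong₂ _*_ (eq s) (∏linear-shift a b s eq)

∏linear-reflect : ∀ a s x → signPow s * ∏linear a s (- x) ≡ ∏linear (λ i → - a i) s x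
∏linear-reflect a zero    x = ℚ.*-identityˡ 1ℚ
∏linear-reflect a (suc s) x = begin
  - σ * ((- x + a s) * P)  ≡⟨ solve 4 (λ σ x a P → :- σ :* ((:- x :+ a) :* P) := (x :+ :- a) :* (σ :* P))
                                      refl σ x (a s) P ⟩
  (x - a s) * (σ * P)      ≡⟨ cong ((x - a s) *_) (∏linear-reflect a s x) ⟩
  (x - a s) * ∏linear (λ i → - a i) s x ∎
  where
  open ≡-Reasoning
  σ = signPow s
  P = ∏linear a s (- x)

-- Falling and rising factorials

falling : ℕ → ℕ → ℕ
falling t       zero    = 1
falling zero    (suc s) = 0
falling (suc t) (suc s) = suc t ℕ.* falling t s

rising : ℕ → ℕ → ℕ
rising n zero    = 1
rising n (suc s) = (n ℕ.+ s) ℕ.* rising n s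

multichoose : ℕ → ℕ → ℕ
multichoose n       zero    = 1
multichoose zero    (suc s) = 0
multichoose (suc n) (suc s) = multichoose (suc n) s ℕ.+ multichoose n (suc s)

falling-sucʳ : ∀ t s → (ℕ→ℚ t - ℕ→ℚ s) * ℕ→ℚ (falling t s) ≡ ℕ→ℚ (falling t (suc s))
falling-sucʳ zero    zero    = refl
falling-sucʳ zero    (suc s) = ℚ.*-zeroʳ (ℕ→ℚ 0 - ℕ→ℚ (suc s))
falling-sucʳ (suc t) zero    =
  trans (solve 1 (λ T → (T :+ :- con 0ℚ) :* con 1ℚ := T :* con 1ℚ) refl (ℕ→ℚ (suc t)))
        (sym (ℕ→ℚ-homo-* (suc t) 1))
falling-sucʳ (suc t) (suc s) = begin
  (ℕ→ℚ (suc t) - ℕ→ℚ (suc s)) * ℕ→ℚ (suc t ℕ.* F)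
    ≡⟨ cong₂ (λ a b → (a - b) * ℕ→ℚ (suc t ℕ.* F)) (ℕ→ℚ-suc t) (ℕ→ℚ-suc s) ⟩
  ((1ℚ + T) - (1ℚ + S)) * ℕ→ℚ (suc t ℕ.* F)
    ≡⟨ cong (((1ℚ + T) - (1ℚ + S)) *_) (ℕ→ℚ-homo-* (suc t) F) ⟩
  ((1ℚ + T) - (1ℚ + S)) * (ℕ→ℚ (suc t) * ℕ→ℚ F)
    ≡⟨ solve 4 (λ T S T′ F → ((con 1ℚ :+ T) :+ :- (con 1ℚ :+ S)) :* (T′ :* F) := T′ :* ((T :+ :- S) :* F))
               refl T S (ℕ→ℚ (suc t)) (ℕ→ℚ F) ⟩
  ℕ→ℚ (suc t) * ((T - S) * ℕ→ℚ F)
    ≡⟨ cong (ℕ→ℚ (suc t) *_) (falling-sucʳ t s) ⟩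
  ℕ→ℚ (suc t) * ℕ→ℚ (falling t (suc s))
    ≡⟨ ℕ→ℚ-homo-* (suc t) (falling t (suc s)) ⟨
  ℕ→ℚ (suc t ℕ.* falling t (suc s))
    ∎
  where
  open ≡-Reasoning
  T = ℕ→ℚ t
  S = ℕ→ℚ s
  F = falling t s

∏linear-falling : ∀ s t → ∏linear (λ i → - ℕ→ℚ i) s (ℕ→ℚ t) ≡ ℕ→ℚ (falling t s)
∏linear-falling zero    t = refl
∏linear-falling (suc s) t = trans (cong ((ℕ→ℚ t - ℕ→ℚ s) *_) (∏linear-falling s t)) (falling-sucʳ t s)

∏linear-rising : ∀ s n → ∏linear (λ i → ℕ→ℚ (suc i)) s (ℕ→ℚ n) ≡ ℕ→ℚ (rising (suc n) s)
∏linear-rising zero    n = refl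
∏linear-rising (suc s) n = begin
  (ℕ→ℚ n + ℕ→ℚ (suc s)) * ∏linear (λ i → ℕ→ℚ (suc i)) s (ℕ→ℚ n)
    ≡⟨ cong₂ _*_ (sym (ℕ→ℚ-homo-+ n (suc s))) (∏linear-rising s n) ⟩
  ℕ→ℚ (n ℕ.+ suc s) * ℕ→ℚ (rising (suc n) s)
    ≡⟨ ℕ→ℚ-homo-* (n ℕ.+ suc s) (rising (suc n) s) ⟨
  ℕ→ℚ ((n ℕ.+ suc s) ℕ.* rising (suc n) s)
    ≡⟨ cong (λ m → ℕ→ℚ (m ℕ.* rising (suc n) s)) (ℕ.+-suc n s) ⟩
  ℕ→ℚ (rising (suc n) (suc s))
    ∎
  where open ≡-Reasoning

-- x ↦ -x turns the factor x + (i + 1) into -((x - 1) - i).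
∏linear-reciprocity : ∀ s k
  → signPow s * ∏linear (λ i → ℕ→ℚ (suc i)) s (- ℕ→ℚ (suc k)) ≡ ℕ→ℚ (falling k s)
∏linear-reciprocity s k = begin
  signPow s * ∏linear (λ i → ℕ→ℚ (suc i)) s (- ℕ→ℚ (suc k))  ≡⟨ ∏linear-reflect _ s (ℕ→ℚ (suc k)) ⟩
  ∏linear (λ i → - ℕ→ℚ (suc i)) s (ℕ→ℚ (suc k))              ≡⟨ ∏linear-shift _ _ s shift ⟩
  ∏linear (λ i → - ℕ→ℚ i) s (ℕ→ℚ k)                          ≡⟨ ∏linear-falling s k ⟩
  ℕ→ℚ (falling k s)                                          ∎
  where
  open ≡-Reasoning
  shift : ∀ i → ℕ→ℚ (suc k) - ℕ→ℚ (suc i) ≡ ℕ→ℚ k - ℕ→ℚ i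
  shift i = begin
    ℕ→ℚ (suc k) - ℕ→ℚ (suc i)    ≡⟨ cong₂ _-_ (ℕ→ℚ-suc k) (ℕ→ℚ-suc i) ⟩
    (1ℚ + ℕ→ℚ k) - (1ℚ + ℕ→ℚ i)  ≡⟨ solve 2 (λ K I → (con 1ℚ :+ K) :+ :- (con 1ℚ :+ I) := K :+ :- I)
                                            refl (ℕ→ℚ k) (ℕ→ℚ i) ⟩
    ℕ→ℚ k - ℕ→ℚ i                ∎

rising-sucʳ : ∀ n s → rising n (suc s) ≡ n ℕ.* rising (suc n) s
rising-sucʳ n zero    = trans (ℕ.*-identityʳ (n ℕ.+ 0)) (sym (trans (ℕ.*-identityʳ n) (sym (ℕ.+-identityʳ n))))
rising-sucʳ n (suc s) = begin
  (n ℕ.+ suc s) ℕ.* rising n (suc s)          ≡⟨ cong₂ ℕ._*_ (ℕ.+-suc n s) (rising-sucʳ n s) ⟩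
  (suc n ℕ.+ s) ℕ.* (n ℕ.* rising (suc n) s)  ≡⟨ x∙yz≈y∙xz (suc n ℕ.+ s) n (rising (suc n) s) ⟩
  n ℕ.* ((suc n ℕ.+ s) ℕ.* rising (suc n) s)  ∎
  where open ≡-Reasoning

falling-multichoose : ∀ n s → falling s s ℕ.* multichoose n s ≡ rising n s
falling-multichoose n       zero    = refl
falling-multichoose zero    (suc s) = trans (ℕ.*-zeroʳ (falling (suc s) (suc s))) (sym (rising-sucʳ 0 s))
falling-multichoose (suc n) (suc s) = begin
  suc s ℕ.* F ℕ.* (multichoose (suc n) s ℕ.+ multichoose n (suc s))
    ≡⟨ trans (ℕ.*-distribˡ-+ (suc s ℕ.* F) _ _) (cong (ℕ._+ suc s ℕ.* F ℕ.* multichoose n (suc s))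
                                                      (ℕ.*-assoc (suc s) F _)) ⟩
  suc s ℕ.* (F ℕ.* multichoose (suc n) s) ℕ.+ suc s ℕ.* F ℕ.* multichoose n (suc s)
    ≡⟨ cong₂ (λ a b → suc s ℕ.* a ℕ.+ b) (falling-multichoose (suc n) s) (falling-multichoose n (suc s)) ⟩
  suc s ℕ.* R ℕ.+ rising n (suc s)
    ≡⟨ cong (suc s ℕ.* R ℕ.+_) (rising-sucʳ n s) ⟩
  suc s ℕ.* R ℕ.+ n ℕ.* R
    ≡⟨ trans (cong (λ m → suc m ℕ.* R) (ℕ.+-comm n s)) (ℕ.*-distribʳ-+ R (suc s) n) ⟨
  (suc n ℕ.+ s) ℕ.* R
    ∎
  where
  open ≡-Reasoning
  F = falling s s
  R = rising (suc n) s

-- Counting with Card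

Card-sound : ∀ {A : Set} {P : A → Set} {k} (c : Card P k) i → P (proj₁ c i)
Card-sound (e , _ , spec) i = from (spec (e i)) (i , refl)

Card-⇔ : ∀ {A : Set} {P Q : A → Set} {k} → (∀ a → P a ⇔ Q a) → Card P k → Card Q k
Card-⇔ P⇔Q (e , e-inj , spec) =
  e , e-inj , λ a → mk⇔ (to (spec a) ∘ from (P⇔Q a)) (to (P⇔Q a) ∘ from (spec a))

Card-∅ : ∀ {A : Set} {P : A → Set} → (∀ a → ¬ P a) → Card P 0
Card-∅ ¬P = (λ ()) , (λ { {()} }) , λ a → mk⇔ (⊥-elim ∘ ¬P a) (λ { (() , _) })

Card-≡ : ∀ {A : Set} (a₀ : A) → Card (_≡ a₀) 1
Card-≡ a₀ = (λ _ → a₀) , (λ { {Fin.zero} {Fin.zero} _ → refl })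
          , λ a → mk⇔ (λ eq → Fin.zero , sym eq) (sym ∘ proj₂)

Card-⊤ : ∀ n → Card (λ (_ : Fin n) → ⊤) n
Card-⊤ n = (λ i → i) , (λ eq → eq) , λ i → mk⇔ (λ _ → i , refl) (λ _ → tt)

Card-unique : ∀ {A : Set} {P : A → Set} {k m} → Card P k → Card P m → k ≡ m
Card-unique {P = P} c c′ = Fin.cantor-schröder-bernstein (index-injective c c′) (index-injective c′ c)
  where
  index : ∀ {k m} → Card P k → Card P m → Fin k → Fin m
  index c (_ , _ , spec′) i = proj₁ (to (spec′ _) (Card-sound c i))
  index-correct : ∀ {k m} (c : Card P k) (c′ : Card P m) i → proj₁ c′ (index c c′ i) ≡ proj₁ c i
  index-correct c (_ , _ , spec′) i = proj₂ (to (spec′ _) (Card-sound c i))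
  index-injective : ∀ {k m} (c : Card P k) (c′ : Card P m) → Injective _≡_ _≡_ (index c c′)
  index-injective c c′ {i} {j} eq =
    proj₁ (proj₂ c) (trans (sym (index-correct c c′ i)) (trans (cong (proj₁ c′) eq) (index-correct c c′ j)))

Card-⊎ : ∀ {A : Set} {P Q : A → Set} {k m} → (∀ a → P a → ¬ Q a) → Card P k → Card Q m
  → Card (λ a → P a ⊎ Q a) (k ℕ.+ m)
Card-⊎ {A} {P} {Q} {k} {m} disjoint c@(e , e-inj , spec) c′@(e′ , e′-inj , spec′) =
  enum ∘ Fin.splitAt k , injective , λ a → mk⇔ (complete a) (sound a)
  where
  enum : Fin k ⊎ Fin m → A
  enum (inj₁ i) = e i
  enum (inj₂ j) = e′ j
  enum-injective : ∀ u v → enum u ≡ enum v → u ≡ v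
  enum-injective (inj₁ i) (inj₁ j) eq = cong inj₁ (e-inj eq)
  enum-injective (inj₁ i) (inj₂ j) eq = ⊥-elim (disjoint _ (Card-sound c i) (subst Q (sym eq) (Card-sound c′ j)))
  enum-injective (inj₂ i) (inj₁ j) eq = ⊥-elim (disjoint _ (Card-sound c j) (subst Q eq (Card-sound c′ i)))
  enum-injective (inj₂ i) (inj₂ j) eq = cong inj₂ (e′-inj eq)
  injective : Injective _≡_ _≡_ (enum ∘ Fin.splitAt k)
  injective {i} {j} eq = begin
    i                              ≡⟨ Fin.join-splitAt k m i ⟨
    Fin.join k m (Fin.splitAt k i) ≡⟨ cong (Fin.join k m) (enum-injective (Fin.splitAt k i) (Fin.splitAt k j) eq) ⟩
    Fin.join k m (Fin.splitAt k j) ≡⟨ Fin.join-splitAt k m j ⟩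
    j                              ∎
    where open ≡-Reasoning
  complete : ∀ a → P a ⊎ Q a → ∃ λ i → enum (Fin.splitAt k i) ≡ a
  complete a (inj₁ p) with i , eq ← to (spec a) p  = i Fin.↑ˡ m , trans (cong enum (Fin.splitAt-↑ˡ k i m)) eq
  complete a (inj₂ q) with j , eq ← to (spec′ a) q = k Fin.↑ʳ j , trans (cong enum (Fin.splitAt-↑ʳ k m j)) eq
  sound : ∀ a → (∃ λ i → enum (Fin.splitAt k i) ≡ a) → P a ⊎ Q a
  sound a (i , eq) with Fin.splitAt k i
  ... | inj₁ i′ = inj₁ (subst P eq (Card-sound c i′))
  ... | inj₂ j′ = inj₂ (subst Q eq (Card-sound c′ j′))

Card-map : ∀ {A B : Set} {P : A → Set} {Q : B → Set} {k} (f : A → B)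
  → (∀ a → P a → Q (f a))
  → (∀ a a′ → P a → P a′ → f a ≡ f a′ → a ≡ a′)
  → (∀ b → Q b → ∃ λ a → P a × f a ≡ b)
  → Card P k → Card Q k
Card-map {P = P} {Q} f P⇒Q f-injective Q⊆image c@(e , e-inj , spec) =
  f ∘ e , (e-inj ∘ f-injective _ _ (Card-sound c _) (Card-sound c _)) , λ b → mk⇔ (complete b) (sound b)
  where
  complete : ∀ b → Q b → ∃ λ i → f (e i) ≡ b
  complete b q with a , p , refl ← Q⊆image b q with i , refl ← to (spec a) p = i , refl
  sound : ∀ b → (∃ λ i → f (e i) ≡ b) → Q b
  sound b (i , refl) = P⇒Q (e i) (Card-sound c i)

Card-× : ∀ {A B : Set} {P : A → Set} {Q : B → Set} {k m} → Card P k → Card Q m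
  → Card (λ (a , b) → P a × Q b) (k ℕ.* m)
Card-× {A} {B} {P} {Q} {k} {m} c@(e , e-inj , spec) c′@(e′ , e′-inj , spec′) =
  enum , enum-injective , λ p → mk⇔ (complete p) (sound p)
  where
  enum : Fin (k ℕ.* m) → A × B
  enum i = let (j , j′) = Fin.remQuot {k} m i in e j , e′ j′
  enum-injective : Injective _≡_ _≡_ enum
  enum-injective {i} {j} eq = begin
    i
      ≡⟨ Fin.combine-remQuot {k} m i ⟨
    uncurry (Fin.combine {k}) (Fin.remQuot m i)
      ≡⟨ cong₂ Fin.combine (e-inj (cong proj₁ eq)) (e′-inj (cong proj₂ eq)) ⟩
    uncurry (Fin.combine {k}) (Fin.remQuot m j)
      ≡⟨ Fin.combine-remQuot {k} m j ⟩
    j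
      ∎
    where open ≡-Reasoning
  complete : ∀ p → P (proj₁ p) × Q (proj₂ p) → ∃ λ i → enum i ≡ p
  complete (a , b) (pa , qb) with j , refl ← to (spec a) pa | j′ , refl ← to (spec′ b) qb =
    Fin.combine j j′ , cong (λ (j , j′) → e j , e′ j′) (Fin.remQuot-combine j j′)
  sound : ∀ p → (∃ λ i → enum i ≡ p) → P (proj₁ p) × Q (proj₂ p)
  sound p (i , refl) = Card-sound c _ , Card-sound c′ _

Card-sum : ∀ {A B : Set} {Q : A → B → Set} (m : A → ℕ) → (∀ a → Card (Q a) (m a))
  → (as : List A) → Unique as → Card (λ (a , b) → a ∈ as × Q a b) (sum (List.map m as))
Card-sum m c []       _            = Card-∅ λ { _ (() , _) }
Card-sum {Q = Q} m c (a ∷ as) (a∉as ∷ as!) =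
  Card-⇔ (λ _ → mk⇔ (λ { (inj₁ (refl , q)) → here refl , q ; (inj₂ (i , q)) → there i , q })
                    (λ { (here refl , q) → inj₁ (refl , q) ; (there i , q) → inj₂ (i , q) }))
         (Card-⊎ (λ { _ (refl , _) (i , _) → All.lookup a∉as i refl }) fibre (Card-sum m c as as!))
  where
  fibre : Card (λ (a′ , b) → a′ ≡ a × Q a′ b) (m a)
  fibre = Card-map (a ,_) (λ _ q → refl , q) (λ _ _ _ _ → cong proj₂) (λ { (_ , b) (refl , q) → b , q , refl }) (c a)

Card-decidable : ∀ {A : Set} {P : A → Set} (as : List A) → Unique as → (∀ a → a ∈ as)
  → (∀ a → Dec (P a)) → ∃ (Card P)
Card-decidable {P = P} as as! complete P? =
  _ , Card-map proj₁ (λ _ (_ , p) → p) (λ _ _ _ _ eq → cong (_, tt) eq) (λ a p → (a , tt) , (complete a , p) , refl)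
               (Card-sum (proj₁ ∘ indicator) (proj₂ ∘ indicator) as as!)
  where
  indicator : ∀ a → ∃ (Card (λ (_ : ⊤) → P a))
  indicator a with P? a
  ... | yes p = 1 , Card-⇔ (λ _ → mk⇔ (λ _ → p) (λ _ → refl)) (Card-≡ tt)
  ... | no ¬p = 0 , Card-∅ (λ _ → ¬p)

allVec-complete : ∀ n N (v : Vec (Fin n) N) → v ∈ allVec n N
allVec-complete n zero    []      = here refl
allVec-complete n (suc N) (a ∷ v) = ∈-concatMap⁺ (λ w → List.map (_∷ w) (List.allFin n))
  (Any.map (λ { refl → ∈-map⁺ (_∷ v) (∈-allFin a) }) (allVec-complete n N v))

allVec-unique : ∀ n N → Unique (allVec n N)
allVec-unique n zero    = All.[] ∷ []
allVec-unique n (suc N) = concatMap-unique (allVec n N) (allVec-unique n N)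
  where
  extend : Vec (Fin n) N → List (Vec (Fin n) (suc N))
  extend w = List.map (_∷ w) (List.allFin n)
  concatMap-unique : ∀ ws → Unique ws → Unique (List.concatMap extend ws)
  concatMap-unique []       _            = []
  concatMap-unique (w ∷ ws) (w∉ws ∷ ws!) =
    Unique.++⁺ (Unique.map⁺ Vec.∷-injectiveˡ (Unique.allFin⁺ n)) (concatMap-unique ws ws!) disjoint
    where
    tail-of : ∀ {v w′} → v ∈ extend w′ → Vec.tail v ≡ w′
    tail-of v∈ with _ , _ , refl ← ∈-map⁻ (_∷ _) v∈ = refl
    disjoint : ∀ {v} → ¬ (v ∈ extend w × v ∈ List.concatMap extend ws)
    disjoint (v∈w , v∈ws) =
      All.lookup w∉ws (Any.map (λ v∈w′ → trans (sym (tail-of v∈w)) (tail-of v∈w′)) (∈-concatMap⁻ extend v∈ws))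
                 refl

-- Vectors with distinct or sorted entries

lookup-≗⇒≡ : ∀ {A : Set} {n} (xs ys : Vec A n) → (∀ i → lookup xs i ≡ lookup ys i) → xs ≡ ys
lookup-≗⇒≡ xs ys eq = trans (sym (Vec.tabulate∘lookup xs)) (trans (Vec.tabulate-cong eq) (Vec.tabulate∘lookup ys))

map-injective : ∀ {A B : Set} {n} {f : A → B} → Injective _≡_ _≡_ f → Injective _≡_ _≡_ (Vec.map {n = n} f)
map-injective f-inj {[]}     {[]}     _  = refl
map-injective f-inj {x ∷ xs} {y ∷ ys} eq =
  cong₂ _∷_ (f-inj (Vec.∷-injectiveˡ eq)) (map-injective f-inj (Vec.∷-injectiveʳ eq))

map-surjective : ∀ {A B : Set} {n} (f : A → B) (v : Vec B n) → (∀ α → ∃ λ a → f a ≡ lookup v α)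
  → ∃ λ w → Vec.map f w ≡ v
map-surjective f v preimage = w , lookup-≗⇒≡ _ _ λ α → begin
  lookup (Vec.map f w) α  ≡⟨ Vec.lookup-map α f w ⟩
  f (lookup w α)          ≡⟨ cong f (Vec.lookup∘tabulate (proj₁ ∘ preimage) α) ⟩
  f (proj₁ (preimage α))  ≡⟨ proj₂ (preimage α) ⟩
  lookup v α              ∎
  where
  open ≡-Reasoning
  w = tabulate (proj₁ ∘ preimage)

suc-surjective : ∀ {n} (a : Fin (suc n)) → a ≢ Fin.zero → ∃ λ a′ → Fin.suc a′ ≡ a
suc-surjective Fin.zero    a≢0 = ⊥-elim (a≢0 refl)
suc-surjective (Fin.suc a) _   = a , refl

Distinct : ∀ {t s} → Vec (Fin t) s → Set
Distinct v = ∀ α β → lookup v α ≡ lookup v β → α ≡ β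

distinct? : ∀ {t s} (v : Vec (Fin t) s) → Dec (Distinct v)
distinct? v = Fin.all? λ α → Fin.all? λ β → (lookup v α Fin.≟ lookup v β) →-dec (α Fin.≟ β)

distinct-map⇔ : ∀ {t t′ s} {f : Fin t → Fin t′} → Injective _≡_ _≡_ f → (w : Vec (Fin t) s)
  → Distinct (Vec.map f w) ⇔ Distinct w
distinct-map⇔ {f = f} f-inj w = mk⇔
  (λ fw! α β eq → fw! α β (trans (lookup-map α) (trans (cong f eq) (sym (lookup-map β)))))
  (λ w! α β eq → w! α β (f-inj (trans (sym (lookup-map α)) (trans eq (lookup-map β)))))
  where
  lookup-map : ∀ α → lookup (Vec.map f w) α ≡ f (lookup w α)
  lookup-map α = Vec.lookup-map α f w

Card-distinct : ∀ t s → Card (Distinct {t} {s}) (falling t s)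
Card-distinct t       zero    = Card-⇔ (λ { [] → mk⇔ (λ { _ () }) (λ _ → refl) }) (Card-≡ [])
Card-distinct zero    (suc s) = Card-∅ (λ v _ → Fin.¬Fin0 (lookup v Fin.zero))
Card-distinct (suc t) (suc s) =
  Card-map cons cons-distinct cons-injective cons-surjective (Card-× (Card-⊤ (suc t)) (Card-distinct t s))
  where
  cons : Fin (suc t) × Vec (Fin t) s → Vec (Fin (suc t)) (suc s)
  cons (a , w) = a ∷ Vec.map (Fin.punchIn a) w
  lookup-cons : ∀ a w β → lookup (Vec.map (Fin.punchIn a) w) β ≡ Fin.punchIn a (lookup w β)
  lookup-cons a w β = Vec.lookup-map β (Fin.punchIn a) w
  cons-distinct : ∀ ((a , w) : Fin (suc t) × Vec (Fin t) s) → ⊤ × Distinct w → Distinct (cons (a , w))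
  cons-distinct (a , w) _        Fin.zero    Fin.zero    eq = refl
  cons-distinct (a , w) _        Fin.zero    (Fin.suc β) eq =
    ⊥-elim (Fin.punchInᵢ≢i a (lookup w β) (sym (trans eq (lookup-cons a w β))))
  cons-distinct (a , w) _        (Fin.suc α) Fin.zero    eq =
    ⊥-elim (Fin.punchInᵢ≢i a (lookup w α) (trans (sym (lookup-cons a w α)) eq))
  cons-distinct (a , w) (_ , w!) (Fin.suc α) (Fin.suc β) eq =
    cong Fin.suc (w! α β (Fin.punchIn-injective a _ _ (trans (sym (lookup-cons a w α)) (trans eq (lookup-cons a w β)))))
  cons-injective : ∀ p p′ → ⊤ × Distinct (proj₂ p) → ⊤ × Distinct (proj₂ p′)
    → cons p ≡ cons p′ → p ≡ p′
  cons-injective (a , w) (a′ , w′) _ _ eq with refl , eq′ ← Vec.∷-injective eq =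
    cong (a ,_) (map-injective (Fin.punchIn-injective a _ _) eq′)
  head∉tail : ∀ {a : Fin (suc t)} {u : Vec (Fin (suc t)) s} → Distinct (a ∷ u) → ∀ β → a ≢ lookup u β
  head∉tail au! β eq with () ← au! Fin.zero (Fin.suc β) eq
  cons-surjective : ∀ v → Distinct v → ∃ λ p → (⊤ × Distinct (proj₂ p)) × cons p ≡ v
  cons-surjective (a ∷ u) au!
    with w , refl ← map-surjective (Fin.punchIn a) u (λ β → _ , Fin.punchIn-punchOut (head∉tail au! β)) =
    (a , w) , (tt , to (distinct-map⇔ (Fin.punchIn-injective a _ _) w) u!) , refl
    where
    u! : Distinct (Vec.map (Fin.punchIn a) w)
    u! α β = Fin.suc-injective ∘ au! (Fin.suc α) (Fin.suc β)

DistinctInterior : ∀ {s} k → Vec (Fin (suc (suc k))) s → Set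
DistinctInterior k u = Distinct u × (∀ β → 0 ℕ.< toℕ (lookup u β) × toℕ (lookup u β) ℕ.< suc k)

Card-distinctInterior : ∀ k s → Card (DistinctInterior {s} k) (falling k s)
Card-distinctInterior k s = Card-map {P = Distinct} (Vec.map shift)
  (λ w w! → from (distinct-map⇔ shift-injective w) w! , λ β → bounds (lookup w β) (Vec.lookup-map β shift w))
  (λ _ _ _ _ → map-injective shift-injective)
  (λ u (u! , u-bounds) → let w , eq = map-surjective shift u (λ β → shift-surjective _ (u-bounds β)) in
     w , to (distinct-map⇔ shift-injective w) (subst Distinct (sym eq) u!) , eq)
  (Card-distinct k s)
  where
  shift : Fin k → Fin (suc (suc k))
  shift = Fin.suc ∘ Fin.inject₁
  shift-injective : Injective _≡_ _≡_ shift
  shift-injective = Fin.inject₁-injective ∘ Fin.suc-injective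
  shift-surjective : ∀ a → 0 ℕ.< toℕ a × toℕ a ℕ.< suc k → ∃ λ y → shift y ≡ a
  shift-surjective (Fin.suc a) (_ , s≤s a<k) =
    Fin.lower₁ a (λ eq → ℕ.<-irrefl (sym eq) a<k) , cong Fin.suc (Fin.inject₁-lower₁ a _)
  bounds : ∀ y {a} → a ≡ shift y → 0 ℕ.< toℕ a × toℕ a ℕ.< suc k
  bounds y refl = s≤s z≤n , s≤s (subst (ℕ._< k) (sym (Fin.toℕ-inject₁ y)) (Fin.toℕ<n y))

distinct-surjective : ∀ {s} (r : Vec (Fin s) s) → Distinct r → ∀ α → ∃ λ β → lookup r β ≡ α
distinct-surjective {zero}  r r! ()
distinct-surjective {suc s} r r! α with Fin.any? (λ β → lookup r β Fin.≟ α)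
... | yes hit  = hit
... | no  miss = ⊥-elim (ℕ.<-irrefl refl (Fin.injective⇒≤ skip-injective))
  where
  α≢r : ∀ β → α ≢ lookup r β
  α≢r β eq = miss (β , sym eq)
  skip-injective : Injective _≡_ _≡_ (λ β → Fin.punchOut (α≢r β))
  skip-injective eq = r! _ _ (Fin.punchOut-injective (α≢r _) (α≢r _) eq)

module Inverse {s} (r : Vec (Fin s) s) (r! : Distinct r) where

  inverse : Fin s → Fin s
  inverse α = proj₁ (distinct-surjective r r! α)

  lookup-inverse : ∀ α → lookup r (inverse α) ≡ α
  lookup-inverse α = proj₂ (distinct-surjective r r! α)

  inverse-lookup : ∀ β → inverse (lookup r β) ≡ β
  inverse-lookup β = r! _ _ (lookup-inverse (lookup r β))

-- By induction on n = r β, comparing β with the entry that r ranks n - 1.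
ranking-≤ : ∀ {s} (r r′ : Vec (Fin s) s) → Distinct r
  → (∀ β γ → lookup r β Fin.< lookup r γ → lookup r′ β Fin.< lookup r′ γ)
  → ∀ β → lookup r β Fin.≤ lookup r′ β
ranking-≤ {s} r r′ r! r<⇒r′< β = go (toℕ (lookup r β)) β refl
  where
  open Inverse r r!
  go : ∀ n β → toℕ (lookup r β) ≡ n → n ℕ.≤ toℕ (lookup r′ β)
  go zero    β _      = z≤n
  go (suc n) β rβ≡1+n =
    ℕ.≤-<-trans (go n β′ rβ′≡n) (r<⇒r′< β′ β (subst₂ ℕ._<_ (sym rβ′≡n) (sym rβ≡1+n) (ℕ.n<1+n n)))
    where
    n<s : n ℕ.< s
    n<s = ℕ.<⇒≤ (subst (ℕ._< s) rβ≡1+n (Fin.toℕ<n (lookup r β)))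
    β′ : Fin s
    β′ = inverse (Fin.fromℕ< n<s)
    rβ′≡n : toℕ (lookup r β′) ≡ n
    rβ′≡n = trans (cong toℕ (lookup-inverse (Fin.fromℕ< n<s))) (Fin.toℕ-fromℕ< n<s)

ranking-unique : ∀ {s} {r r′ : Vec (Fin s) s} → Distinct r → Distinct r′
  → (∀ β γ → lookup r β Fin.< lookup r γ → lookup r′ β Fin.< lookup r′ γ)
  → (∀ β γ → lookup r′ β Fin.< lookup r′ γ → lookup r β Fin.< lookup r γ)
  → r ≡ r′
ranking-unique {r = r} {r′} r! r′! r<⇒r′< r′<⇒r< =
  lookup-≗⇒≡ r r′ λ β →
    Fin.≤-antisym (ranking-≤ r r′ r! r<⇒r′< β) (ranking-≤ r′ r r′! r′<⇒r< β)

Sorted : ∀ {n s} → Vec (Fin n) s → Set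
Sorted v = ∀ α β → α Fin.≤ β → lookup v α Fin.≤ lookup v β

sorted-zero∷⇔ : ∀ {n s} (w : Vec (Fin (suc n)) s) → Sorted (Fin.zero ∷ w) ⇔ Sorted w
sorted-zero∷⇔ w = mk⇔ (λ sorted α β le → sorted (Fin.suc α) (Fin.suc β) (s≤s le)) cons-sorted
  where
  cons-sorted : Sorted w → Sorted (Fin.zero ∷ w)
  cons-sorted sorted Fin.zero    _           _        = z≤n
  cons-sorted sorted (Fin.suc α) (Fin.suc β) (s≤s le) = sorted α β le

sorted-map-suc⇔ : ∀ {n s} (w : Vec (Fin n) s) → Sorted (Vec.map Fin.suc w) ⇔ Sorted w
sorted-map-suc⇔ w = mk⇔
  (λ sorted α β le → ℕ.≤-pred (subst₂ Fin._≤_ (lookup-suc α) (lookup-suc β) (sorted α β le)))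
  (λ sorted α β le → subst₂ Fin._≤_ (sym (lookup-suc α)) (sym (lookup-suc β)) (s≤s (sorted α β le)))
  where
  lookup-suc : ∀ α → lookup (Vec.map Fin.suc w) α ≡ Fin.suc (lookup w α)
  lookup-suc α = Vec.lookup-map α Fin.suc w

Card-sorted : ∀ n s → Card (Sorted {n} {s}) (multichoose n s)
Card-sorted n       zero    = Card-⇔ (λ { [] → mk⇔ (λ { _ () }) (λ _ → refl) }) (Card-≡ [])
Card-sorted zero    (suc s) = Card-∅ (λ v _ → Fin.¬Fin0 (lookup v Fin.zero))
Card-sorted (suc n) (suc s) = Card-⇔ by-head (Card-⊎ (λ _ (eq , _) (neq , _) → neq eq) head-zero head-suc)
  where
  HeadZero HeadSuc : Vec (Fin (suc n)) (suc s) → Set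
  HeadZero v = Vec.head v ≡ Fin.zero × Sorted v
  HeadSuc  v = Vec.head v ≢ Fin.zero × Sorted v
  by-head : ∀ v → (HeadZero v ⊎ HeadSuc v) ⇔ Sorted v
  by-head v = mk⇔ (λ { (inj₁ (_ , sorted)) → sorted ; (inj₂ (_ , sorted)) → sorted })
                  (split (Vec.head v Fin.≟ Fin.zero))
    where
    split : Dec (Vec.head v ≡ Fin.zero) → Sorted v → HeadZero v ⊎ HeadSuc v
    split (yes eq)  sorted = inj₁ (eq , sorted)
    split (no  neq) sorted = inj₂ (neq , sorted)
  head-zero : Card HeadZero (multichoose (suc n) s)
  head-zero = Card-map (Fin.zero ∷_) (λ w sorted → refl , from (sorted-zero∷⇔ w) sorted)
                       (λ _ _ _ _ → Vec.∷-injectiveʳ)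
                       (λ { (_ ∷ w) (refl , sorted) → w , to (sorted-zero∷⇔ w) sorted , refl })
                       (Card-sorted (suc n) s)
  nonzero : ∀ v → HeadSuc v → ∀ α → lookup v α ≢ Fin.zero
  nonzero (a ∷ w) (a≢0 , sorted) α eq =
    a≢0 (Fin.toℕ-injective (ℕ.n≤0⇒n≡0 (subst (λ x → toℕ a ℕ.≤ toℕ x) eq (sorted Fin.zero α z≤n))))
  head-suc : Card HeadSuc (multichoose n (suc s))
  head-suc = Card-map (Vec.map Fin.suc) (λ { (a ∷ w) sorted → (λ ()) , from (sorted-map-suc⇔ (a ∷ w)) sorted })
                      (λ _ _ _ _ → map-injective Fin.suc-injective)
                      surjective
                      (Card-sorted n (suc s))
    where
    surjective : ∀ v → HeadSuc v → ∃ λ w → Sorted w × Vec.map Fin.suc w ≡ v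
    surjective v v-suc@(_ , sorted) with w , refl ← map-surjective Fin.suc v (suc-surjective _ ∘ nonzero v v-suc) =
      w , to (sorted-map-suc⇔ w) sorted , refl

SortedBy : ∀ {n s} → Vec (Fin s) s → Vec (Fin n) s → Set
SortedBy r u = ∀ β γ → lookup r β Fin.< lookup r γ → lookup u β Fin.≤ lookup u γ

sortedBy? : ∀ {n s} (r : Vec (Fin s) s) (u : Vec (Fin n) s) → Dec (SortedBy r u)
sortedBy? r u =
  Fin.all? λ β → Fin.all? λ γ → (lookup r β Fin.<? lookup r γ) →-dec (lookup u β Fin.≤? lookup u γ)

Card-sortedBy : ∀ n s → Card (λ ((u , r) : Vec (Fin n) s × Vec (Fin s) s) → Distinct r × SortedBy r u)
                             (multichoose n s ℕ.* falling s s)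
Card-sortedBy n s = Card-map (λ (w , r) → Vec.map (lookup w) r , r) sortedBy injective surjective
  (Card-× (Card-sorted n s) (Card-distinct s s))
  where
  lookup-∘ : ∀ (w : Vec (Fin n) s) r β → lookup (Vec.map (lookup w) r) β ≡ lookup w (lookup r β)
  lookup-∘ w r β = Vec.lookup-map β (lookup w) r
  sortedBy : ∀ ((w , r) : Vec (Fin n) s × Vec (Fin s) s) → Sorted w × Distinct r
    → Distinct r × SortedBy r (Vec.map (lookup w) r)
  sortedBy (w , r) (w-sorted , r!) = r! , λ β γ lt →
    subst₂ Fin._≤_ (sym (lookup-∘ w r β)) (sym (lookup-∘ w r γ)) (w-sorted _ _ (ℕ.<⇒≤ lt))
  injective : ∀ p p′ → Sorted (proj₁ p) × Distinct (proj₂ p) → Sorted (proj₁ p′) × Distinct (proj₂ p′)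
    → (Vec.map (lookup (proj₁ p)) (proj₂ p) , proj₂ p) ≡ (Vec.map (lookup (proj₁ p′)) (proj₂ p′) , proj₂ p′)
    → p ≡ p′
  injective (w , r) (w′ , r′) (_ , r!) _ eq with refl ← cong proj₂ eq = cong (_, r) (lookup-≗⇒≡ w w′ λ α →
    subst (λ α → lookup w α ≡ lookup w′ α) (lookup-inverse α)
      (trans (sym (lookup-∘ w r _)) (trans (cong (λ v → lookup v (inverse α)) (cong proj₁ eq)) (lookup-∘ w′ r _))))
    where open Inverse r r!
  surjective : ∀ ((u , r) : Vec (Fin n) s × Vec (Fin s) s) → Distinct r × SortedBy r u
    → ∃ λ ((w , r′) : Vec (Fin n) s × Vec (Fin s) s)
        → (Sorted w × Distinct r′) × (Vec.map (lookup w) r′ , r′) ≡ (u , r)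
  surjective (u , r) (r! , u-sortedBy) = (w , r) , (w-sorted , r!) , cong (_, r) (lookup-≗⇒≡ _ _ λ β →
      trans (lookup-∘ w r β) (trans (lookup-w (lookup r β)) (cong (lookup u) (inverse-lookup β))))
    where
    open Inverse r r!
    w : Vec (Fin n) s
    w = tabulate (lookup u ∘ inverse)
    lookup-w : ∀ α → lookup w α ≡ lookup u (inverse α)
    lookup-w = Vec.lookup∘tabulate (lookup u ∘ inverse)
    w-sorted : Sorted w
    w-sorted α α′ α≤α′ with ℕ.m≤n⇒m<n∨m≡n α≤α′
    ... | inj₂ α≡α′ = Fin.≤-reflexive (cong (lookup w) (Fin.toℕ-injective α≡α′))
    ... | inj₁ α<α′ = subst₂ Fin._≤_ (sym (lookup-w α)) (sym (lookup-w α′))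
                        (u-sortedBy _ _ (subst₂ Fin._<_ (sym (lookup-inverse α)) (sym (lookup-inverse α′)) α<α′))

module _ {A : Set} {P Q : A → Set} (P? : Decidable P) (Q? : Decidable Q) (P⇒Q : ∀ {a} → P a → Q a) where

  count-mono-≤ : ∀ {n} (xs : Vec A n) → Vec.count P? xs ℕ.≤ Vec.count Q? xs
  count-mono-≤ []       = z≤n
  count-mono-≤ (x ∷ xs) with P? x | Q? x
  ... | yes _ | yes _ = s≤s (count-mono-≤ xs)
  ... | yes p | no ¬q = ⊥-elim (¬q (P⇒Q p))
  ... | no _  | yes _ = ℕ.m≤n⇒m≤1+n (count-mono-≤ xs)
  ... | no _  | no _  = count-mono-≤ xs

  count-mono-< : ∀ {n a} (xs : Vec A n) → a ∈ᵥ xs → Q a → ¬ P a → Vec.count P? xs ℕ.< Vec.count Q? xs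
  count-mono-< (x ∷ xs) (here refl) q ¬p with P? x | Q? x
  ... | yes p | _     = ⊥-elim (¬p p)
  ... | no _  | no ¬q = ⊥-elim (¬q q)
  ... | no _  | yes _ = s≤s (count-mono-≤ xs)
  count-mono-< (x ∷ xs) (there a∈xs) q ¬p with P? x | Q? x
  ... | yes _ | yes _ = s≤s (count-mono-< xs a∈xs q ¬p)
  ... | yes p | no ¬q = ⊥-elim (¬q (P⇒Q p))
  ... | no _  | yes _ = ℕ.m<n⇒m<1+n (count-mono-< xs a∈xs q ¬p)
  ... | no _  | no _  = count-mono-< xs a∈xs q ¬p

count-< : ∀ {A : Set} {P : A → Set} (P? : Decidable P) {n a} (xs : Vec A n) → a ∈ᵥ xs → ¬ P a
  → Vec.count P? xs ℕ.< n
count-< P? (x ∷ xs) (here refl) ¬p with P? x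
... | yes p = ⊥-elim (¬p p)
... | no _  = s≤s (Vec.count≤n P? xs)
count-< P? (x ∷ xs) (there a∈xs) ¬p with does (P? x)
... | true  = s≤s (count-< P? xs a∈xs ¬p)
... | false = ℕ.m<n⇒m<1+n (count-< P? xs a∈xs ¬p)

module Ranks (O : StrictTotalOrder 0ℓ 0ℓ 0ℓ) {s : ℕ} (Y : Fin s → StrictTotalOrder.Carrier O) where
  open StrictTotalOrder O using (_<_; _<?_; irrefl; module Eq) renaming (trans to <-trans)

  rank : Fin s → ℕ
  rank β = Vec.count (λ γ → Y γ <? Y β) (Vec.allFin s)

  rank-< : ∀ β → rank β ℕ.< s
  rank-< β = count-< (λ γ → Y γ <? Y β) (Vec.allFin s) (∈-allFin⁺ β) (irrefl Eq.refl)

  rank-mono : ∀ {β γ} → Y β < Y γ → rank β ℕ.< rank γ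
  rank-mono {β} {γ} Yβ<Yγ =
    count-mono-< (λ δ → Y δ <? Y β) (λ δ → Y δ <? Y γ) (λ Yδ<Yβ → <-trans Yδ<Yβ Yβ<Yγ)
                 (Vec.allFin s) (∈-allFin⁺ β) Yβ<Yγ (irrefl Eq.refl)

  ranking : Vec (Fin s) s
  ranking = tabulate λ β → Fin.fromℕ< (rank-< β)

  ranking-mono : ∀ {β γ} → Y β < Y γ → lookup ranking β Fin.< lookup ranking γ
  ranking-mono {β} {γ} lt = subst₂ ℕ._<_ (sym (toℕ-ranking β)) (sym (toℕ-ranking γ)) (rank-mono lt)
    where
    toℕ-ranking : ∀ β → toℕ (lookup ranking β) ≡ rank β
    toℕ-ranking β = trans (cong toℕ (Vec.lookup∘tabulate _ β)) (Fin.toℕ-fromℕ< (rank-< β))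

from-does-true : ∀ {A : Set} (d : Dec A) → does d ≡ true → A
from-does-true (yes a) _  = a
from-does-true (no _)  ()

from-does-false : ∀ {A : Set} (d : Dec A) → does d ≡ false → ¬ A
from-does-false (yes _) ()
from-does-false (no ¬a) _  = ¬a

module _ (n : ℕ) where
  private instance
    1+n-positive : ℚ.Positive (ℕ→ℚ (suc n))
    1+n-positive = ℚ.normalize-pos (suc n) 1
    1+n-nonZero : ℚ.NonZero (ℕ→ℚ (suc n))
    1+n-nonZero = ℚ.pos⇒nonZero (ℕ→ℚ (suc n))
    ε-positive : ℚ.Positive (ℚ.1/ ℕ→ℚ (suc n))
    ε-positive = ℚ.1/pos⇒pos (ℕ→ℚ (suc n))
    ε-nonNegative : ℚ.NonNegative (ℚ.1/ ℕ→ℚ (suc n))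
    ε-nonNegative = ℚ.pos⇒nonNeg (ℚ.1/ ℕ→ℚ (suc n))

  scaled : ℕ → ℚ
  scaled a = ℕ→ℚ a * ℚ.1/ ℕ→ℚ (suc n)

  scaled-mono-< : ∀ {a a′} → a ℕ.< a′ → scaled a ℚ.< scaled a′
  scaled-mono-< lt = ℚ.*-monoˡ-<-pos (ℚ.1/ ℕ→ℚ (suc n)) (ℕ→ℚ-mono-< lt)

  scaled-nonNeg : ∀ a → 0ℚ ℚ.≤ scaled a
  scaled-nonNeg a = subst (ℚ._≤ scaled a) (ℚ.*-zeroˡ (ℚ.1/ ℕ→ℚ (suc n)))
                          (ℚ.*-monoʳ-≤-nonNeg (ℚ.1/ ℕ→ℚ (suc n)) (ℕ→ℚ-mono-≤ {0} {a} z≤n))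

  scaled-≤-1 : ∀ {a} → a ℕ.≤ suc n → scaled a ℚ.≤ 1ℚ
  scaled-≤-1 {a} a≤1+n = subst (scaled a ℚ.≤_) (ℚ.*-inverseʳ (ℕ→ℚ (suc n)))
                               (ℚ.*-monoʳ-≤-nonNeg (ℚ.1/ ℕ→ℚ (suc n)) (ℕ→ℚ-mono-≤ a≤1+n))

-- Block-constant vectors

module Blocks {N s : ℕ} (b : Fin N → Fin s) (b-surjective : Surjective _≡_ _≡_ b) where

  rep : Fin s → Fin N
  rep β = proj₁ (b-surjective β)

  b-rep : ∀ β → b (rep β) ≡ β
  b-rep β = proj₂ (b-surjective β) refl

  BlockConstant : ∀ {A : Set} → Vec A N → Set
  BlockConstant x = ∀ i j → b i ≡ b j → lookup x i ≡ lookup x j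

  blockConstant? : ∀ {t} (x : Vec (Fin t) N) → Dec (BlockConstant x)
  blockConstant? x = Fin.all? λ i → Fin.all? λ j → (b i Fin.≟ b j) →-dec (lookup x i Fin.≟ lookup x j)

  lift : ∀ {A : Set} → Vec A s → Vec A N
  lift u = tabulate (lookup u ∘ b)

  restrict : ∀ {A : Set} → Vec A N → Vec A s
  restrict x = tabulate (lookup x ∘ rep)

  lookup-lift : ∀ {A : Set} (u : Vec A s) i → lookup (lift u) i ≡ lookup u (b i)
  lookup-lift u = Vec.lookup∘tabulate (lookup u ∘ b)

  lookup-restrict : ∀ {A : Set} (x : Vec A N) β → lookup (restrict x) β ≡ lookup x (rep β)
  lookup-restrict x = Vec.lookup∘tabulate (lookup x ∘ rep)

  lookup-restrict-b : ∀ {A : Set} (x : Vec A N) → BlockConstant x → ∀ i → lookup (restrict x) (b i) ≡ lookup x i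
  lookup-restrict-b x x-const i = trans (lookup-restrict x (b i)) (x-const (rep (b i)) i (b-rep (b i)))

  lift-blockConstant : ∀ {A : Set} (u : Vec A s) → BlockConstant (lift u)
  lift-blockConstant u i j eq = trans (lookup-lift u i) (trans (cong (lookup u) eq) (sym (lookup-lift u j)))

  restrict-lift : ∀ {A : Set} (u : Vec A s) → restrict (lift u) ≡ u
  restrict-lift u = lookup-≗⇒≡ _ _ λ β →
    trans (lookup-restrict (lift u) β) (trans (lookup-lift u (rep β)) (cong (lookup u) (b-rep β)))

  lift-restrict : ∀ {A : Set} (x : Vec A N) → BlockConstant x → lift (restrict x) ≡ x
  lift-restrict x x-const = lookup-≗⇒≡ _ _ λ i → trans (lookup-lift (restrict x) i) (lookup-restrict-b x x-const i)

  lift-injective : ∀ {A : Set} {u u′ : Vec A s} → lift u ≡ lift u′ → u ≡ u′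
  lift-injective {u = u} {u′} eq = trans (sym (restrict-lift u)) (trans (cong restrict eq) (restrict-lift u′))

  Card-blockConstant : ∀ {A : Set} {P : Vec A s → Set} {k}
    → Card P k → Card (λ x → BlockConstant x × P (restrict x)) k
  Card-blockConstant {P = P} = Card-map lift
    (λ u p → lift-blockConstant u , subst P (sym (restrict-lift u)) p)
    (λ _ _ _ _ → lift-injective)
    (λ x (x-const , p) → restrict x , p , lift-restrict x x-const)

  distinct-restrict⇔ : ∀ {t} (x : Vec (Fin t) N) → BlockConstant x
    → Distinct (restrict x) ⇔ (∀ i j → lookup x i ≡ lookup x j → b i ≡ b j)
  distinct-restrict⇔ x x-const = mk⇔
    (λ x! i j eq → x! (b i) (b j) (trans (lookup-restrict-b x x-const i) (trans eq (sym (lookup-restrict-b x x-const j)))))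
    (λ separates β γ eq → trans (sym (b-rep β)) (trans (separates (rep β) (rep γ)
       (trans (sym (lookup-restrict x β)) (trans eq (lookup-restrict x γ)))) (b-rep γ)))

-- Colorings, interior points and closed regions

module Setting {N s : ℕ} (adj : Fin N → Fin N → Bool) (b : Fin N → Fin s) (b-surjective : Surjective _≡_ _≡_ b)
               (independent : ∀ i j → adj i j ≡ true → b i ≢ b j) where
  open Blocks b b-surjective

  Hyp⇒≢ : ∀ {i j} → Hyp adj b i j → b i ≢ b j
  Hyp⇒≢ {i} {j} (inj₁ edge) = independent i j edge
  Hyp⇒≢         (inj₂ b≢)   = b≢

  same-block⇔¬Hyp : ∀ i j → b i ≡ b j ⇔ (¬ Hyp adj b i j)
  same-block⇔¬Hyp i j = mk⇔ (λ eq h → Hyp⇒≢ h eq) (λ ¬h → decidable-stable (b i Fin.≟ b j) (¬h ∘ inj₂))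

  rep-Hyp : ∀ {β γ} → β ≢ γ → Hyp adj b (rep β) (rep γ)
  rep-Hyp {β} {γ} β≢γ = inj₂ (λ eq → β≢γ (trans (sym (b-rep β)) (trans eq (b-rep γ))))

  coloring⇔ : ∀ {k} (c : Vec (Fin k) N) → (BlockConstant c × Distinct (restrict c)) ⇔ ColoringIn adj b k c
  coloring⇔ c = mk⇔
    (λ (c-const , c!) → let separates = to (distinct-restrict⇔ c c-const) c! in
       (λ i j edge eq → independent i j edge (separates i j eq)) , λ i j → mk⇔ (separates i j) (c-const i j))
    (λ (_ , same⇔) → let c-const i j = from (same⇔ i j) in
       c-const , from (distinct-restrict⇔ c c-const) (λ i j → to (same⇔ i j)))

  Card-colorings : ∀ k → Card (ColoringIn adj b k) (falling k s)
  Card-colorings k = Card-⇔ coloring⇔ (Card-blockConstant (Card-distinct k s))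

  pt-injective : ∀ {t} (x : Vec (Fin (suc t)) N) {i j} → pt adj b x i ≡ pt adj b x j → lookup x i ≡ lookup x j
  pt-injective x eq = Fin.toℕ-injective (ℕ→ℚ-injective eq)

  pt-InTP : ∀ {t} (x : Vec (Fin (suc t)) N) → BlockConstant x → InTP adj b t (pt adj b x)
  pt-InTP x x-const =
    (λ i → ℕ→ℚ-mono-≤ {0} {toℕ (lookup x i)} z≤n , ℕ→ℚ-mono-≤ (ℕ.≤-pred (Fin.toℕ<n (lookup x i))))
    , λ i j eq → cong (ℕ→ℚ ∘ toℕ) (x-const i j eq)

  interior⇔ : ∀ {k} (x : Vec (Fin (suc (suc k))) N)
    → (BlockConstant x × DistinctInterior k (restrict x)) ⇔ InteriorPt adj b (suc k) x
  interior⇔ {k} x = mk⇔ interior blocks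
    where
    interior : BlockConstant x × DistinctInterior k (restrict x) → InteriorPt adj b (suc k) x
    interior (x-const , x! , bounds) = (inside , λ i j eq → cong (ℕ→ℚ ∘ toℕ) (x-const i j eq)) , off
      where
      inside : ∀ i → (0ℚ ℚ.< pt adj b x i) × (pt adj b x i ℚ.< ℕ→ℚ (suc k))
      inside i rewrite sym (lookup-restrict-b x x-const i) with 0<xi , xi<1+k ← bounds (b i) =
        ℕ→ℚ-mono-< 0<xi , ℕ→ℚ-mono-< xi<1+k
      off : OffH adj b (pt adj b x)
      off i j h eq = Hyp⇒≢ h (to (distinct-restrict⇔ x x-const) x! i j (pt-injective x eq))
    blocks : InteriorPt adj b (suc k) x → BlockConstant x × DistinctInterior k (restrict x)
    blocks ((inside , pt-const) , off) = x-const , x! , bounds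
      where
      x-const : BlockConstant x
      x-const i j eq = pt-injective x (pt-const i j eq)
      x! : Distinct (restrict x)
      x! = from (distinct-restrict⇔ x x-const) λ i j eq →
        decidable-stable (b i Fin.≟ b j) (λ b≢ → off i j (inj₂ b≢) (cong (ℕ→ℚ ∘ toℕ) eq))
      bounds : ∀ β → 0 ℕ.< toℕ (lookup (restrict x) β) × toℕ (lookup (restrict x) β) ℕ.< suc k
      bounds β rewrite lookup-restrict x β with 0<xβ , xβ<1+k ← inside (rep β) =
        ℕ→ℚ-cancel-< 0<xβ , ℕ→ℚ-cancel-< xβ<1+k

  Card-interior : ∀ k → Card (InteriorPt adj b (suc k)) (falling k s)
  Card-interior k = Card-⇔ interior⇔ (Card-blockConstant (Card-distinctInterior k s))

  ranking-pattern : Vec (Fin s) s → Pattern adj b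
  ranking-pattern r = tabulate λ i → tabulate λ j → does (lookup r (b i) Fin.<? lookup r (b j))

  pat-ranking-pattern : ∀ r i j → pat adj b (ranking-pattern r) i j ≡ does (lookup r (b i) Fin.<? lookup r (b j))
  pat-ranking-pattern r i j = trans (cong (λ row → lookup row j) (Vec.lookup∘tabulate _ i))
                                    (Vec.lookup∘tabulate (λ j → does (lookup r (b i) Fin.<? lookup r (b j))) j)

  ranking-pattern-true⇔ : ∀ r i j → pat adj b (ranking-pattern r) i j ≡ true ⇔ lookup r (b i) Fin.< lookup r (b j)
  ranking-pattern-true⇔ r i j = mk⇔ (λ e → from-does-true (_ Fin.<? _) (trans (sym (pat-ranking-pattern r i j)) e))
                                    (λ lt → trans (pat-ranking-pattern r i j) (dec-true (_ Fin.<? _) lt))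

  ranking-pattern-false⇔ : ∀ r i j
    → pat adj b (ranking-pattern r) i j ≡ false ⇔ (¬ lookup r (b i) Fin.< lookup r (b j))
  ranking-pattern-false⇔ r i j = mk⇔ (λ e → from-does-false (_ Fin.<? _) (trans (sym (pat-ranking-pattern r i j)) e))
                                     (λ ≮ → trans (pat-ranking-pattern r i j) (dec-false (_ Fin.<? _) ≮))

  ranking-pattern-order : ∀ {r r′} → ranking-pattern r ≡ ranking-pattern r′
    → ∀ β γ → lookup r β Fin.< lookup r γ → lookup r′ β Fin.< lookup r′ γ
  ranking-pattern-order {r} {r′} eq β γ lt =
    subst₂ (λ β γ → lookup r′ β Fin.< lookup r′ γ) (b-rep β) (b-rep γ)
    (to (ranking-pattern-true⇔ r′ (rep β) (rep γ)) (trans (cong (λ p → pat adj b p (rep β) (rep γ)) (sym eq))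
      (from (ranking-pattern-true⇔ r (rep β) (rep γ))
        (subst₂ (λ β γ → lookup r β Fin.< lookup r γ) (sym (b-rep β)) (sym (b-rep γ)) lt))))

  Compatible : ∀ {t} → Vec (Fin (suc t)) N → Vec (Fin s) s → Set
  Compatible x r = Distinct r × BlockConstant x × SortedBy r (restrict x)

  compatible? : ∀ {t} (x : Vec (Fin (suc t)) N) r → Dec (Compatible x r)
  compatible? x r = distinct? r ×-dec blockConstant? x ×-dec sortedBy? r (restrict x)

  ranking-closedRegion : ∀ {t} → 1 ℕ.≤ t → ∀ x r → Compatible {t} x r
    → InClosedRegion adj b t (pt adj b x) (ranking-pattern r)
  ranking-closedRegion {t} 1≤t x r (r! , x-const , x-sorted) = (y , y∈tP , sides , off) , pt-InTP x x-const , below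
    where
    -- The ranks are scaled into [0, 1] ⊆ [0, t]: there may be more blocks than t.
    y : Fin N → ℚ
    y i = scaled s (toℕ (lookup r (b i)))
    y∈tP : InTP adj b t y
    y∈tP = (λ i → scaled-nonNeg s (toℕ (lookup r (b i)))
                , ℚ.≤-trans (scaled-≤-1 s (ℕ.m≤n⇒m≤1+n (ℕ.<⇒≤ (Fin.toℕ<n (lookup r (b i))))))
                            (ℕ→ℚ-mono-≤ {1} {t} 1≤t))
         , λ i j eq → cong (scaled s ∘ toℕ ∘ lookup r) eq
    sides : ∀ i j → Hyp adj b i j → (pat adj b (ranking-pattern r) i j ≡ true → y i ℚ.< y j)
                                  × (pat adj b (ranking-pattern r) i j ≡ false → y j ℚ.< y i)
    sides i j h = (λ e → scaled-mono-< s (to (ranking-pattern-true⇔ r i j) e))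
                , (λ e → scaled-mono-< s (Fin.≤∧≢⇒< (ℕ.≮⇒≥ (to (ranking-pattern-false⇔ r i j) e))
                                                     (Hyp⇒≢ h ∘ r! _ _ ∘ sym)))
    off : ∀ i j → ¬ Hyp adj b i j → pat adj b (ranking-pattern r) i j ≡ false
    off i j ¬h = from (ranking-pattern-false⇔ r i j) (Fin.<-irrefl (cong (lookup r) (from (same-block⇔¬Hyp i j) ¬h)))
    below : ∀ i j → Hyp adj b i j → pat adj b (ranking-pattern r) i j ≡ true → pt adj b x i ℚ.≤ pt adj b x j
    below i j _ e = ℕ→ℚ-mono-≤ (subst₂ Fin._≤_ (lookup-restrict-b x x-const i) (lookup-restrict-b x x-const j)
                                 (x-sorted _ _ (to (ranking-pattern-true⇔ r i j) e)))

  realizable⇒ranking : ∀ {t p} → Realizable adj b t p → ∃ λ r → Distinct r × ranking-pattern r ≡ p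
  realizable⇒ranking {t} {p} (y , (_ , y-const) , sides , off) =
    ranking , ranking! , lookup-≗⇒≡ _ _ λ i → lookup-≗⇒≡ _ _ λ j → same-pattern i j (b i Fin.≟ b j)
    where
    open Ranks ℚ.<-strictTotalOrder (y ∘ rep)
    ranking-mono-b : ∀ {i j} → y i ℚ.< y j → lookup ranking (b i) Fin.< lookup ranking (b j)
    ranking-mono-b {i} {j} lt =
      ranking-mono (subst₂ ℚ._<_ (sym (y-const _ _ (b-rep (b i)))) (sym (y-const _ _ (b-rep (b j)))) lt)
    separated : ∀ {i j} → Hyp adj b i j → y i ℚ.< y j ⊎ y j ℚ.< y i
    separated {i} {j} h with pat adj b p i j in e
    ... | true  = inj₁ (proj₁ (sides i j h) e)
    ... | false = inj₂ (proj₂ (sides i j h) e)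
    ranking! : Distinct ranking
    ranking! β γ eq = decidable-stable (β Fin.≟ γ) λ β≢γ →
      Sum.[ Fin.<-irrefl eq ∘ ranking-mono , Fin.<-irrefl (sym eq) ∘ ranking-mono ] (separated (rep-Hyp β≢γ))
    same-pattern : ∀ i j → Dec (b i ≡ b j) → pat adj b (ranking-pattern ranking) i j ≡ pat adj b p i j
    same-pattern i j (yes eq) = trans (from (ranking-pattern-false⇔ ranking i j) (Fin.<-irrefl (cong (lookup ranking) eq)))
                                      (sym (off i j (to (same-block⇔¬Hyp i j) eq)))
    same-pattern i j (no b≢) with pat adj b p i j in e
    ... | true  = from (ranking-pattern-true⇔ ranking i j) (ranking-mono-b (proj₁ (sides i j (inj₂ b≢)) e))
    ... | false = from (ranking-pattern-false⇔ ranking i j) (Fin.<-asym (ranking-mono-b (proj₂ (sides i j (inj₂ b≢)) e)))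

  closure⇒sortedBy : ∀ {t} (x : Vec (Fin (suc t)) N) r → InClosure adj b t (ranking-pattern r) (pt adj b x)
    → BlockConstant x × SortedBy r (restrict x)
  closure⇒sortedBy x r ((_ , pt-const) , below) = x-const , sorted
    where
    x-const : BlockConstant x
    x-const i j eq = pt-injective x (pt-const i j eq)
    sorted : SortedBy r (restrict x)
    sorted β γ lt = subst₂ Fin._≤_ (sym (lookup-restrict x β)) (sym (lookup-restrict x γ)) (ℕ→ℚ-cancel-≤
      (below (rep β) (rep γ) (rep-Hyp (λ { refl → Fin.<-irrefl refl lt }))
        (from (ranking-pattern-true⇔ r (rep β) (rep γ))
          (subst₂ (λ β γ → lookup r β Fin.< lookup r γ) (sym (b-rep β)) (sym (b-rep γ)) lt))))

  Card-closedRegions : ∀ {t m} → 1 ℕ.≤ t → (x : Vec (Fin (suc t)) N) → Card (Compatible x) m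
    → Card (InClosedRegion adj b t (pt adj b x)) m
  Card-closedRegions {t} 1≤t x = Card-map ranking-pattern (ranking-closedRegion 1≤t x)
    (λ r r′ (r! , _) (r′! , _) eq →
       ranking-unique r! r′! (ranking-pattern-order {r} {r′} eq) (ranking-pattern-order {r′} {r} (sym eq)))
    (λ p (realizable , closure) → let r , r! , eq = realizable⇒ranking {t} realizable in
       r , (r! , closure⇒sortedBy x r (subst (λ p → InClosure adj b t p (pt adj b x)) (sym eq) closure)) , eq)

  Card-compatible : ∀ t → Card (λ ((x , r) : Vec (Fin (suc t)) N × Vec (Fin s) s) → Compatible x r)
                               (multichoose (suc t) s ℕ.* falling s s)
  Card-compatible t = Card-map (λ (u , r) → lift u , r)
    (λ (u , r) (r! , u-sorted) → r! , lift-blockConstant u , subst (SortedBy r) (sym (restrict-lift u)) u-sorted)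
    (λ _ _ _ _ eq → cong₂ _,_ (lift-injective (cong proj₁ eq)) (cong proj₂ eq))
    (λ (x , r) (r! , x-const , x-sorted) → (restrict x , r) , (r! , x-sorted) , cong (_, r) (lift-restrict x x-const))
    (Card-sortedBy (suc t) s)

  regionCount : ∀ {t} → Vec (Fin (suc t)) N → ℕ
  regionCount x = proj₁ (Card-decidable (allVec s s) (allVec-unique s s) (allVec-complete s s) (compatible? x))

  Card-regionCount : ∀ {t} (x : Vec (Fin (suc t)) N) → Card (Compatible x) (regionCount x)
  Card-regionCount x = proj₂ (Card-decidable (allVec s s) (allVec-unique s s) (allVec-complete s s) (compatible? x))

  sum-regionCount : ∀ t → sum (List.map regionCount (allVec (suc t) N)) ≡ rising (suc t) s
  sum-regionCount t = begin
    sum (List.map regionCount (allVec (suc t) N))  ≡⟨ Card-unique compatible-by-point (Card-compatible t) ⟩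
    multichoose (suc t) s ℕ.* falling s s          ≡⟨ ℕ.*-comm (multichoose (suc t) s) (falling s s) ⟩
    falling s s ℕ.* multichoose (suc t) s          ≡⟨ falling-multichoose (suc t) s ⟩
    rising (suc t) s                               ∎
    where
    open ≡-Reasoning
    compatible-by-point : Card (λ ((x , r) : Vec (Fin (suc t)) N × Vec (Fin s) s) → Compatible x r)
                               (sum (List.map regionCount (allVec (suc t) N)))
    compatible-by-point = Card-⇔ (λ (x , _) → mk⇔ proj₂ (allVec-complete (suc t) N x ,_))
      (Card-sum regionCount Card-regionCount (allVec (suc t) N) (allVec-unique (suc t) N))

  E-value : ∀ t → 1 ℕ.≤ t → EVal adj b t (rising (suc t) s)
  E-value t 1≤t = regionCount , (λ x → Card-closedRegions 1≤t x (Card-regionCount x)) , sum-regionCount t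

theorem5p10 : (N s : ℕ) (adj : Fin N → Fin N → Bool)
    → (∀ i j → adj i j ≡ adj j i)
    → (∀ i → adj i i ≡ false)
    → (b : Fin N → Fin s)
    → Surjective _≡_ _≡_ b
    → (∀ i j → adj i j ≡ true → b i ≢ b j)
    → (Σ[ pE ∈ List ℚ ]
          ((∀ k → Σ[ e ∈ ℕ ] (EVal adj b (suc k) e × (evalPoly pE (ℕ→ℚ (suc k)) ≡ ℕ→ℚ e)))
          × (∀ k → Σ[ n ∈ ℕ ] Σ[ c ∈ ℕ ]
                (Card (InteriorPt adj b (suc k)) n
                × Card (ColoringIn adj b k) c
                × (signPow s * evalPoly pE (- ℕ→ℚ (suc k)) ≡ ℕ→ℚ n)
                × (n ≡ c)))))
      × (Σ[ q ∈ List ℚ ] ((length q ≡ s)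
          × (∀ t → Σ[ c ∈ ℕ ] (Card (ColoringIn adj b t) c × (evalPoly (q ++ [ 1ℚ ]) (ℕ→ℚ t) ≡ ℕ→ℚ c)))))
theorem5p10 N s adj _ _ b b-surjective independent =
  (toList E-coefficients ++ [ 1ℚ ] ,
     (λ k → rising (suc (suc k)) s , E-value (suc k) (s≤s z≤n) , E-polynomial k) ,
     (λ k → falling k s , falling k s , Card-interior k , Card-colorings k , reciprocity k , refl)) ,
  (toList χ-coefficients , Vec.length-toList χ-coefficients , λ t → falling t s , Card-colorings t , χ-polynomial t)
  where
  open Setting adj b b-surjective independent
  E-coefficients χ-coefficients : Vec ℚ s
  E-coefficients = monicProduct (λ i → ℕ→ℚ (suc i)) s
  χ-coefficients = monicProduct (λ i → - ℕ→ℚ i) s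
  E-polynomial : ∀ k → evalMonic E-coefficients (ℕ→ℚ (suc k)) ≡ ℕ→ℚ (rising (suc (suc k)) s)
  E-polynomial k = trans (evalMonic-monicProduct _ s _) (∏linear-rising s (suc k))
  reciprocity : ∀ k → signPow s * evalMonic E-coefficients (- ℕ→ℚ (suc k)) ≡ ℕ→ℚ (falling k s)
  reciprocity k = trans (cong (signPow s *_) (evalMonic-monicProduct _ s _)) (∏linear-reciprocity s k)
  χ-polynomial : ∀ t → evalMonic χ-coefficients (ℕ→ℚ t) ≡ ℕ→ℚ (falling t s)
  χ-polynomial t = trans (evalMonic-monicProduct _ s _) (∏linear-falling s t)
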